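{- If a natural number $n$ has exactly two odd exponents in its $\varphi$-representation, then these two exponents are either $3$ and $1$, or $2i+1$ and $1-2i$ for some integer $i \ge 1$. Furthermore, each possibility occurs: there is a natural number whose $\varphi$-representation has exactly two odd exponents, namely $3$ and $1$, and for every integer $i \ge 1$ there is a natural number whose $\varphi$-representation has exactly two odd exponents, namely $2i+1$ and $1-2i$.
   Context: $\varphi = (1+\sqrt{5})/2$. Every real $x \ge 0$ has a unique $\varphi$-representation $x = \sum_{i \le t} e_i \varphi^i$ with $e_i \in \{0,1\}$, $e_i e_{i+1} = 0$ for all $i$, and no infinite tail $1010\cdots$; for natural numbers it is finite. The exponents of the representation are the integers $i$ with $e_i = 1$. -}

module Defs where

open import Data.Nat using (ℕ; zero; suc)
open import Data.Integer using (ℤ; +_; -[1+_]; _+_; _-_; _≤_; ∣_∣)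
open import Data.Product using (_×_; _,_)
open import Data.List using (List; []; _∷_)
open import Data.Bool using (Bool; true; false; if_then_else_)
open import Relation.Binary.PropositionalEquality using (_≡_)

-- Elements of ℤ[φ] ⊂ ℝ, the pair (a , b) standing for a + b·φ.
-- Since φ is irrational, a + bφ = a' + b'φ in ℝ iff a ≡ a' and b ≡ b'.
ℤφ : Set
ℤφ = ℤ × ℤ

_⊕_ : ℤφ → ℤφ → ℤφ
(a , b) ⊕ (c , d) = (a + c , b + d)

-- multiplication by φ  : (a + bφ)φ     = b + (a+b)φ      (φ² = φ + 1)
mulφ : ℤφ → ℤφ
mulφ (a , b) = (b , a + b)

-- multiplication by φ⁻¹ = φ - 1 : (a + bφ)(φ-1) = (b - a) + aφ
mulφ⁻¹ : ℤφ → ℤφ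
mulφ⁻¹ (a , b) = (b - a , a)

iterate : ℕ → (ℤφ → ℤφ) → ℤφ → ℤφ
iterate zero    f x = x
iterate (suc n) f x = f (iterate n f x)

φ^ : ℤ → ℤφ
φ^ (+ n)     = iterate n mulφ (+ 1 , + 0)
φ^ -[1+ n ]  = iterate (suc n) mulφ⁻¹ (+ 1 , + 0)

evalRep : List ℤ → ℤφ
evalRep []       = (+ 0 , + 0)
evalRep (i ∷ is) = φ^ i ⊕ evalRep is

-- A finite set of exponents with no two consecutive, listed in strictly
-- decreasing order with gaps ≥ 2 (i.e. e_i e_{i+1} = 0).
data Gapped : List ℤ → Set where
  nil  : Gapped []
  one  : ∀ x → Gapped (x ∷ [])
  cons : ∀ {x y ys} → y + + 2 ≤ x → Gapped (y ∷ ys) → Gapped (x ∷ y ∷ ys)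

-- R (list of exponents) is the φ-representation of the natural number n.
-- (Finite by the standing fact that representations of naturals are finite;
--  unique by the standard uniqueness theorem.)
IsPhiRep : ℕ → List ℤ → Set
IsPhiRep n R = Gapped R × evalRep R ≡ (+ n , + 0)

oddℕ : ℕ → Bool
oddℕ zero          = false
oddℕ (suc zero)    = true
oddℕ (suc (suc n)) = oddℕ n

oddExps : List ℤ → List ℤ
oddExps []       = []
oddExps (x ∷ xs) = if oddℕ ∣ x ∣ then x ∷ oddExps xs else oddExps xs

-- Write φ^i = F_{i-1} + F_i φ for all integers i, where F_{-k} = (-1)^{k+1} F_k. A
-- φ-representation of a natural number has vanishing φ-part; with P its positive
-- exponents and S the absolute values of its negative ones (exponent 0 contributes F_0 = 0)
-- this reads  Σ_P F + Σ_{S odd} F = Σ_{S even} F,  where P and S are sparse: no two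
-- elements are consecutive. A sparse set bounded by m sums to at most F_{m+1}, strictly
-- less if m is even, and its even part always sums to less than F_{m+1}. These bounds
-- force the top of S to be even and to be matched in P either by itself, when both
-- cancel, or by its predecessor. In the latter case exactly one odd exponent remains, and
-- the bounds pin it down: the odd exponents are 3 and 1, or 2i+1 and 1-2i.
module Submission where

open import Defs

module SparseFibonacciSums where

  open import Data.Bool using (Bool; true; false; not)
  open import Data.List using (List; []; _∷_; map; length; filterᵇ)
  open import Data.List.Relation.Binary.Permutation.Propositional using (_↭_)
  open import Data.List.Relation.Binary.Permutation.Propositional.Properties using (map⁺; filter-↭)
  open import Data.Nat
  open import Data.Nat.ListAction using (sum)
  open import Data.Nat.ListAction.Properties using (sum-↭)
  open import Data.Nat.Properties
  open import Data.Product using (_×_; _,_; ∃-syntax)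
  open import Data.Sum using (inj₁; inj₂)
  open import Function using (_∘_)
  open import Relation.Binary.Definitions using (tri<; tri≈; tri>)
  open import Relation.Binary.PropositionalEquality
  open import Relation.Nullary using (contradiction)
  open import Relation.Nullary.Decidable using (T?)

  private variable
    m n k q : ℕ
    xs ys P S : List ℕ

  oddℕ-suc : ∀ n → oddℕ (suc n) ≡ not (oddℕ n)
  oddℕ-suc zero          = refl
  oddℕ-suc (suc zero)    = refl
  oddℕ-suc (suc (suc n)) = oddℕ-suc n

  even⇒suc-odd : ∀ n → oddℕ n ≡ false → oddℕ (suc n) ≡ true
  even⇒suc-odd n h = trans (oddℕ-suc n) (cong not h)

  oddℕ-double : ∀ n → oddℕ (n + n) ≡ false
  oddℕ-double zero    = refl
  oddℕ-double (suc n) rewrite +-suc n n = oddℕ-double n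

  odd⇒suc-double : oddℕ k ≡ true → ∃[ j ] k ≡ suc (j + j)
  odd⇒suc-double {suc zero}    _ = 0 , refl
  odd⇒suc-double {suc (suc k)} h with odd⇒suc-double {k} h
  ... | j , refl = suc j , cong (suc ∘ suc) (sym (+-suc j j))

  ≤∧separated⇒< : ∀ (p : ℕ → Bool) → p m ≡ true → p n ≡ false → m ≤ n → m < n
  ≤∧separated⇒< p pm pn m≤n = ≤∧≢⇒< m≤n λ { refl → contradiction (trans (sym pm) pn) λ () }

  fib : ℕ → ℕ
  fib 0             = 0
  fib 1             = 1
  fib (suc (suc n)) = fib (suc n) + fib n

  fib-pos : ∀ n → 0 < fib (suc n)
  fib-pos zero    = ≤-refl
  fib-pos (suc n) = <-≤-trans (fib-pos n) (m≤m+n _ _)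

  fib-mono : m ≤ n → fib m ≤ fib n
  fib-mono {zero}        _               = z≤n
  fib-mono {suc zero}    {suc n} _       = fib-pos n
  fib-mono {suc (suc m)} (s≤s (s≤s m≤n)) = +-mono-≤ (fib-mono (s≤s m≤n)) (fib-mono m≤n)

  fib-< : 2 ≤ m → m < n → fib m < fib n
  fib-< {suc zero}    (s≤s ()) _
  fib-< {suc (suc m)} _ m<n = <-≤-trans (m<m+n (fib (2 + m)) (fib-pos m)) (fib-mono m<n)

  data Sparse : ℕ → List ℕ → Set where
    []  : Sparse m []
    _∷_ : suc n ≤ m → Sparse (n ∸ 1) xs → Sparse m (suc n ∷ xs)

  sparse-weaken : m ≤ n → Sparse m xs → Sparse n xs
  sparse-weaken m≤n []      = []
  sparse-weaken m≤n (h ∷ s) = ≤-trans h m≤n ∷ s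

  sparse-head-≤ : Sparse m (k ∷ xs) → k ≤ m
  sparse-head-≤ (h ∷ _) = h

  sparse-filterᵇ : ∀ p → Sparse m xs → Sparse m (filterᵇ p xs)
  sparse-filterᵇ p [] = []
  sparse-filterᵇ p (_∷_ {n = x} h s) with p (suc x)
  ... | true  = h ∷ sparse-filterᵇ p s
  ... | false = sparse-weaken (≤-trans (m∸n≤m x 1) (<⇒≤ h)) (sparse-filterᵇ p s)

  sparse-filterᵇ-pred : ∀ p → p (suc m) ≡ false → Sparse (suc m) xs → Sparse m (filterᵇ p xs)
  sparse-filterᵇ-pred p pm [] = []
  sparse-filterᵇ-pred p pm (_∷_ {n = x} h s) with p (suc x) in px
  ... | true  = ≤-pred (≤∧separated⇒< p px pm h) ∷ sparse-filterᵇ p s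
  ... | false = sparse-weaken (≤-trans (m∸n≤m x 1) (≤-pred h)) (sparse-filterᵇ p s)

  odds evens : List ℕ → List ℕ
  odds  = filterᵇ oddℕ
  evens = filterᵇ (not ∘ oddℕ)

  odds≡[]⇒evens-id : ∀ xs → odds xs ≡ [] → evens xs ≡ xs
  odds≡[]⇒evens-id []       _ = refl
  odds≡[]⇒evens-id (x ∷ xs) h with oddℕ x
  ... | false = cong (x ∷_) (odds≡[]⇒evens-id xs h)

  odds-↭ : xs ↭ ys → odds xs ↭ odds ys
  odds-↭ = filter-↭ (T? ∘ oddℕ)

  evens-↭ : xs ↭ ys → evens xs ↭ evens ys
  evens-↭ = filter-↭ (T? ∘ not ∘ oddℕ)

  fibSum : List ℕ → ℕ
  fibSum = sum ∘ map fib

  fibSum-↭ : xs ↭ ys → fibSum xs ≡ fibSum ys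
  fibSum-↭ = sum-↭ ∘ map⁺ fib

  fibSum-≤ : Sparse m xs → fibSum xs ≤ fib (suc m)
  fibSum-≤ []                    = z≤n
  fibSum-≤ (_∷_ {n = zero} h []) = fib-mono (s≤s h)
  fibSum-≤ (_∷_ {n = suc x} h s) =
    ≤-trans (+-monoʳ-≤ (fib (2 + x)) (fibSum-≤ s)) (fib-mono (s≤s h))

  fibSum-<-even : oddℕ m ≡ false → Sparse m xs → fibSum xs < fib (suc m)
  fibSum-<-even {m} _ [] = fib-pos m
  fibSum-<-even hm (_∷_ {n = x} h s) with oddℕ (suc x) in hx
  ... | true =
    ≤-<-trans (fibSum-≤ (≤-refl {suc x} ∷ s)) (fib-< (s≤s (s≤s z≤n)) (s≤s (≤∧separated⇒< oddℕ hx hm h)))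
  fibSum-<-even hm (_∷_ {n = suc x} h s) | false =
    <-≤-trans (+-monoʳ-< (fib (2 + x)) (fibSum-<-even hx s)) (fib-mono (s≤s h))
  fibSum-<-even _ (_∷_ {n = zero} _ _) | false = contradiction hx λ ()

  fibSum-evens-< : Sparse m xs → fibSum (evens xs) < fib (suc m)
  fibSum-evens-< {m} [] = fib-pos m
  fibSum-evens-< (_∷_ {n = x} h s) with oddℕ (suc x) in hx
  ... | true = <-≤-trans (fibSum-evens-< s) (fib-mono (s≤s (≤-trans (m∸n≤m x 1) (<⇒≤ h))))
  fibSum-evens-< (_∷_ {n = suc x} h s) | false =
    <-≤-trans (+-monoʳ-< (fib (2 + x)) (fibSum-evens-< s)) (fib-mono (s≤s h))
  fibSum-evens-< (_∷_ {n = zero} _ _) | false = contradiction hx λ ()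

  fibSum-odds-≤ : oddℕ m ≡ false → Sparse m xs → fibSum (odds xs) ≤ fib m
  fibSum-odds-≤ {zero}  _  [] = z≤n
  fibSum-odds-≤ {suc m} hm s  = fibSum-≤ (sparse-filterᵇ-pred oddℕ hm s)

  -- The φ-coordinate of Σ_{p ∈ P} φ^p + Σ_{s ∈ S} φ^(-s) vanishes, because φ^(-s) has
  -- φ-coordinate (-1)^(s+1) F_s.
  Balanced : List ℕ → List ℕ → Set
  Balanced P S = fibSum P + fibSum (odds S) ≡ fibSum (evens S)

  Balanced-↭ : ∀ {S′} → S ↭ S′ → Balanced P S → Balanced P S′
  Balanced-↭ {P = P} ρ eq =
    trans (cong (fibSum P +_) (sym (fibSum-↭ (odds-↭ ρ)))) (trans eq (fibSum-↭ (evens-↭ ρ)))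

  data TwoOdds : List ℕ → List ℕ → Set where
    three-one : TwoOdds (3 ∷ 1 ∷ []) []
    adjacent  : oddℕ k ≡ true → TwoOdds (2 + k ∷ []) (k ∷ [])

  fibSum-<-single-odd : Sparse (2 + m) P → length (odds P) ≤ 1 → fibSum P < fib (3 + m)
  fibSum-<-single-odd {m} [] _ = fib-pos (2 + m)
  fibSum-<-single-odd (_∷_ {n = x} h s) c with oddℕ (suc x) in hx
  ... | false = <-≤-trans (fibSum-<-even hx (≤-refl {suc x} ∷ s)) (fib-mono (s≤s h))
  fibSum-<-single-odd {m} (_∷_ {n = zero} _ []) _ | true =
    fib-< {2} {3 + m} ≤-refl (s≤s (s≤s (s≤s z≤n)))
  fibSum-<-single-odd (_∷_ {n = zero} _ (() ∷ _)) _ | true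
  fibSum-<-single-odd (_∷_ {n = suc x} {xs = xs} h s) c | true with odds xs in ox
  ... | [] = <-≤-trans (+-monoʳ-< (fib (2 + x)) fibSum-xs<) (fib-mono (s≤s h))
    where
    fibSum-xs< : fibSum xs < fib (suc x)
    fibSum-xs< = subst (λ ys → fibSum ys < fib (suc x)) (odds≡[]⇒evens-id xs ox) (fibSum-evens-< s)
  fibSum-<-single-odd (_∷_ {n = suc x} h s) (s≤s ()) | true | _ ∷ _

  fibSum-single-odd-tight : Sparse (suc m) P → odds P ≡ q ∷ [] → fib (2 + m) ≤ fibSum P →
                            m ≡ 0 × q ≡ 1
  fibSum-single-odd-tight {zero} []                           ()   _
  fibSum-single-odd-tight {zero} (_∷_ {n = zero} _ [])        refl _ = refl , refl
  fibSum-single-odd-tight {zero} (_∷_ {n = zero} _ (() ∷ _))  _    _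
  fibSum-single-odd-tight {zero} (_∷_ {n = suc _} (s≤s ()) _) _    _
  fibSum-single-odd-tight {suc m} s oP ge =
    contradiction ge (<⇒≱ (fibSum-<-single-odd s (≤-reflexive (cong length oP))))

  unbalanced-below : oddℕ m ≡ false → Sparse m P → Sparse m S →
                     fibSum P + fibSum (odds S) < fib (2 + m) + fibSum (evens S)
  unbalanced-below {m} {P} {S} hm sP sS = begin-strict
    fibSum P + fibSum (odds S)     <⟨ +-mono-<-≤ (fibSum-<-even hm sP) (fibSum-odds-≤ hm sS) ⟩
    fib (suc m) + fib m            ≤⟨ m≤m+n _ _ ⟩
    fib (2 + m) + fibSum (evens S) ∎
    where open ≤-Reasoning

  twoOdds-one-left : oddℕ m ≡ false → Sparse (m ∸ 1) P → Sparse m S →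
                     fibSum P + fibSum (odds S) ≡ fib m + fibSum (evens S) →
                     length (odds P) + length (odds S) ≡ 1 → TwoOdds (suc m ∷ odds P) (odds S)
  twoOdds-one-left {zero} _ []       []       _ ()
  twoOdds-one-left {zero} _ (() ∷ _) _        _ _
  twoOdds-one-left {zero} _ []       (() ∷ _) _ _
  twoOdds-one-left {suc (suc m)} {P} {S} hm sP sS eq count with odds P in oP | odds S in oS
  ... | []        | []        = contradiction count λ ()
  ... | []        | _ ∷ _ ∷ _ = contradiction count λ ()
  ... | _ ∷ []    | _ ∷ _     = contradiction count λ ()
  ... | _ ∷ _ ∷ _ | _         = contradiction count λ ()
  ... | q ∷ []    | []
    with fibSum-single-odd-tight sP oP
           (≤-trans (m≤m+n _ _) (≤-reflexive (trans (sym eq) (+-identityʳ _))))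
  ...   | refl , refl = three-one
  twoOdds-one-left {suc (suc m)} {P} {S} hm sP sS eq count | [] | k ∷ []
    with m≤n⇒m<n∨m≡n (sparse-head-≤ (subst (Sparse (suc m)) oS (sparse-filterᵇ-pred oddℕ hm sS)))
  ... | inj₂ refl      = adjacent (even⇒suc-odd m hm)
  ... | inj₁ (s≤s k≤m) = contradiction eq (<⇒≢ (begin-strict
    fibSum P + fibSum (k ∷ [])     <⟨ +-mono-<-≤ (fibSum-<-even hm sP′) fib-k≤ ⟩
    fib (suc m) + fib m            ≤⟨ m≤m+n _ _ ⟩
    fib (2 + m) + fibSum (evens S) ∎))
    where
    open ≤-Reasoning
    sP′ : Sparse m P
    sP′ = subst (Sparse m) (odds≡[]⇒evens-id P oP)
                (sparse-filterᵇ-pred (not ∘ oddℕ) (cong not (even⇒suc-odd m hm)) sP)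
    fib-k≤ : fibSum (k ∷ []) ≤ fib m
    fib-k≤ = ≤-trans (≤-reflexive (+-identityʳ (fib k))) (fib-mono k≤m)

  twoOdds : Sparse m P → Sparse n S → Balanced P S →
            length (odds P) + length (odds S) ≡ 2 → TwoOdds (odds P) (odds S)

  -- Compare the largest element of P with the top 2 + m of S: if it is at most m the
  -- left side is too small, if it exceeds 2 + m it is too large; 2 + m cancels against
  -- the top, and 1 + m leaves the balance of twoOdds-one-left.
  twoOdds-even-top : oddℕ m ≡ false → Sparse n P → Sparse m S →
                     fibSum P + fibSum (odds S) ≡ fib (2 + m) + fibSum (evens S) →
                     length (odds P) + length (odds S) ≡ 2 → TwoOdds (odds P) (odds S)
  twoOdds-even-top hm [] sS eq _ = contradiction eq (<⇒≢ (unbalanced-below hm [] sS))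
  twoOdds-even-top {m} hm (_∷_ {n = l} _ sP) sS eq count with <-cmp l m
  ... | tri< l<m _ _ = contradiction eq (<⇒≢ (unbalanced-below hm (l<m ∷ sP) sS))
  ... | tri≈ _ refl _ with oddℕ (suc m) | even⇒suc-odd m hm
  ...   | true | refl =
    twoOdds-one-left hm sP sS (+-cancelˡ-≡ (fib (suc m)) _ _
      (trans (sym (+-assoc (fib (suc m)) _ _)) (trans eq (+-assoc (fib (suc m)) (fib m) _))))
      (suc-injective count)
  twoOdds-even-top {m} {S = S} hm (_∷_ {n = l} {xs = P} _ sP) sS eq count | tri> _ _ m<l
    with m≤n⇒m<n∨m≡n m<l
  ...   | inj₁ 2+m≤l = contradiction eq (>⇒≢ (begin-strict
    fib (2 + m) + fibSum (evens S)           <⟨ +-monoʳ-< (fib (2 + m)) (fibSum-evens-< sS) ⟩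
    fib (3 + m)                              ≤⟨ fib-mono (s≤s 2+m≤l) ⟩
    fib (suc l)                              ≤⟨ m≤m+n _ _ ⟩
    fib (suc l) + fibSum P                   ≤⟨ m≤m+n _ _ ⟩
    fib (suc l) + fibSum P + fibSum (odds S) ∎))
    where open ≤-Reasoning
  ...   | inj₂ refl with oddℕ m | hm
  ...     | false | refl =
    twoOdds sP sS (+-cancelˡ-≡ (fib (2 + m)) _ _ (trans (sym (+-assoc (fib (2 + m)) _ _)) eq)) count

  twoOdds [] [] _ ()
  twoOdds (_∷_ {n = x} _ _) [] eq _ = contradiction (m+n≡0⇒m≡0 _ (m+n≡0⇒m≡0 _ eq)) (>⇒≢ (fib-pos x))
  twoOdds {P = P} sP (_∷_ {n = y} {xs = S} _ sS) eq count with oddℕ (suc y) in hy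
  ... | true = contradiction eq (>⇒≢ (begin-strict
    fibSum (evens S)                           <⟨ fibSum-evens-< sS ⟩
    fib (suc (y ∸ 1))                          ≤⟨ fib-mono (s≤s (m∸n≤m y 1)) ⟩
    fib (suc y)                                ≤⟨ m≤m+n _ _ ⟩
    fib (suc y) + fibSum (odds S)              ≤⟨ m≤n+m _ (fibSum P) ⟩
    fibSum P + (fib (suc y) + fibSum (odds S)) ∎))
    where open ≤-Reasoning
  twoOdds sP (_∷_ {n = suc m} _ sS) eq count | false = twoOdds-even-top hy sP sS eq count
  twoOdds _  (_∷_ {n = zero} _ _)   _  _     | false = contradiction hy λ ()

open import Data.Nat using (ℕ)
open import Data.Integer using (ℤ; +_; _+_; _-_; _*_; _≤_)
open import Data.Product using (_×_; _,_; ∃-syntax)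
open import Data.Sum using (_⊎_)
open import Data.List using (List; []; _∷_)
open import Relation.Binary.PropositionalEquality using (_≡_)

open import Data.Bool using (true; false; if_then_else_)
open import Data.Integer using (-[1+_]; -_; +≤+; -≤+; -≤-)
import Data.Integer.Properties as ℤ
open import Data.Integer.Tactic.RingSolver using (solve-∀)
open import Data.List using (map; length; _++_; reverse; reverseAcc)
open import Data.List.Properties using (length-++; length-map)
open import Data.List.Relation.Binary.Permutation.Propositional using (_↭_; ↭-sym)
open import Data.List.Relation.Binary.Permutation.Propositional.Properties
  using (↭-reverse; ↭-length; ↭-empty-inv; ↭-singleton-inv)
open import Data.Nat as ℕ using (zero; suc; z≤n; s≤s)
import Data.Nat.Properties as ℕ
open import Algebra.Properties.CommutativeSemigroup ℕ.+-commutativeSemigroup using (x∙yz≈y∙xz)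
open import Data.Product using (proj₂)
open import Data.Sum using (inj₁; inj₂)
open import Function using (_∘_)
open import Relation.Binary.PropositionalEquality
  using (refl; sym; trans; cong; cong₂; module ≡-Reasoning)
open import Relation.Nullary using (contradiction)

open SparseFibonacciSums

fib₋ : ℕ → ℤ
fib₋ k = if oddℕ k then + fib k else - + fib k

fib₋-rec : ∀ k → fib₋ (2 ℕ.+ k) ≡ fib₋ k - fib₋ (suc k)
fib₋-rec k rewrite oddℕ-suc k with oddℕ k
... | true  = add-neg-neg (+ fib k) (+ fib (suc k))
  where
  add-neg-neg : ∀ a b → b + a ≡ a - - b
  add-neg-neg = solve-∀
... | false = neg-add (+ fib k) (+ fib (suc k))
  where
  neg-add : ∀ a b → - (b + a) ≡ - a - b
  neg-add = solve-∀

φ^-pos : ∀ n → φ^ (+ suc n) ≡ (+ fib n , + fib (suc n))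
φ^-pos zero    = refl
φ^-pos (suc n) =
  trans (cong mulφ (φ^-pos n)) (cong (λ b → + fib (suc n) , + b) (ℕ.+-comm (fib n) (fib (suc n))))

φ^-neg : ∀ n → φ^ -[1+ n ] ≡ (fib₋ (2 ℕ.+ n) , fib₋ (suc n))
φ^-neg zero    = refl
φ^-neg (suc n) =
  trans (cong mulφ⁻¹ (φ^-neg n)) (cong (_, fib₋ (2 ℕ.+ n)) (sym (fib₋-rec (suc n))))

φ^-neg-even : ∀ n → oddℕ n ≡ false → φ^ -[1+ n ] ≡ (- + fib (2 ℕ.+ n) , + fib (suc n))
φ^-neg-even n even = trans (φ^-neg n) signs
  where
  signs : (fib₋ (2 ℕ.+ n) , fib₋ (suc n)) ≡ (- + fib (2 ℕ.+ n) , + fib (suc n))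
  signs rewrite oddℕ-suc n | even = refl

φ^-neg-odd : ∀ n → oddℕ n ≡ true → φ^ -[1+ n ] ≡ (+ fib (2 ℕ.+ n) , - + fib (suc n))
φ^-neg-odd n odd = trans (φ^-neg n) signs
  where
  signs : (fib₋ (2 ℕ.+ n) , fib₋ (suc n)) ≡ (+ fib (2 ℕ.+ n) , - + fib (suc n))
  signs rewrite oddℕ-suc n | odd = refl

positives : List ℤ → List ℕ
positives []             = []
positives (+ zero ∷ R)   = positives R
positives (+ suc n ∷ R)  = suc n ∷ positives R
positives (-[1+ _ ] ∷ R) = positives R

negatives : List ℤ → List ℕ
negatives []             = []
negatives (+ _ ∷ R)      = negatives R
negatives (-[1+ n ] ∷ R) = suc n ∷ negatives R

pos-summand : ∀ {a c e} f {x} → a ≡ + f → c + e ≡ + x → a + c + e ≡ + (f ℕ.+ x)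
pos-summand {c = c} {e} f refl h = trans (ℤ.+-assoc (+ f) c e) (cong (_+_ (+ f)) h)

neg-summand-cancels : ∀ {a} c e f → a ≡ - + f → a + c + (+ f + e) ≡ c + e
neg-summand-cancels c e f refl = cancel (+ f) c e
  where
  cancel : ∀ f c e → - f + c + (f + e) ≡ c + e
  cancel = solve-∀

evalRep-φ-part : ∀ R → proj₂ (evalRep R) + + fibSum (evens (negatives R))
                       ≡ + (fibSum (positives R) ℕ.+ fibSum (odds (negatives R)))
evalRep-φ-part [] = refl
evalRep-φ-part (+ zero ∷ R) =
  trans (cong (_+ + fibSum (evens (negatives R))) (ℤ.+-identityˡ (proj₂ (evalRep R))))
        (evalRep-φ-part R)
evalRep-φ-part (+ suc n ∷ R) =
  trans (pos-summand (fib (suc n)) (cong proj₂ (φ^-pos n)) (evalRep-φ-part R))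
        (cong +_ (sym (ℕ.+-assoc (fib (suc n)) _ _)))
evalRep-φ-part (-[1+ n ] ∷ R) with oddℕ (suc n) | cong proj₂ (φ^-neg n)
... | true  | φ-part =
  trans (pos-summand (fib (suc n)) φ-part (evalRep-φ-part R))
        (cong +_ (x∙yz≈y∙xz (fib (suc n)) (fibSum (positives R)) (fibSum (odds (negatives R)))))
... | false | φ-part =
  trans (neg-summand-cancels (proj₂ (evalRep R)) _ (fib (suc n)) φ-part) (evalRep-φ-part R)

IsPhiRep⇒Balanced : ∀ {n R} → IsPhiRep n R → Balanced (positives R) (negatives R)
IsPhiRep⇒Balanced {R = R} (_ , value) = sym (ℤ.+-injective (begin
  + fibSum E                                               ≡⟨ cong (λ v → proj₂ v + + fibSum E) value ⟨
  proj₂ (evalRep R) + + fibSum E                           ≡⟨ evalRep-φ-part R ⟩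
  + (fibSum (positives R) ℕ.+ fibSum (odds (negatives R))) ∎))
  where
  open ≡-Reasoning
  E = evens (negatives R)

Gapped-tail : ∀ {x R} → Gapped (x ∷ R) → Gapped R
Gapped-tail (one _)    = nil
Gapped-tail (cons _ g) = g

gap-below-negative : ∀ {y n} → y + + 2 ≤ -[1+ n ] → ∃[ c ] (y ≡ -[1+ 2 ℕ.+ c ] × n ℕ.≤ c)
gap-below-negative { -[1+ suc (suc c) ]} (-≤- n≤c) = c , refl , n≤c

positives-after-nonpositive : ∀ {x R} → Gapped (x ∷ R) → x ≤ + 0 → positives R ≡ []
positives-after-nonpositive (one _) _ = refl
positives-after-nonpositive (cons {y = + k} y+2≤x _) x≤0 with ℤ.≤-trans y+2≤x x≤0
... | +≤+ k+2≤0 = contradiction (ℕ.m+n≤o⇒n≤o k k+2≤0) λ ()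
positives-after-nonpositive (cons {y = -[1+ _ ]} _ g) _ = positives-after-nonpositive g -≤+

positives-sparse-from : ∀ {m R} → Gapped (+ m ∷ R) → Sparse m (positives (+ m ∷ R))
positives-sparse-from {zero} g rewrite positives-after-nonpositive g ℤ.≤-refl = []
positives-sparse-from {suc m} (one _) = ℕ.≤-refl ∷ []
positives-sparse-from {suc m} (cons {y = + k} (+≤+ k+2≤m) g) =
  ℕ.≤-refl ∷ sparse-weaken (ℕ.m+n≤o⇒m≤o∸n k k+2≤m) (positives-sparse-from g)
positives-sparse-from {suc m} (cons {y = -[1+ _ ]} _ g)
  rewrite positives-after-nonpositive g -≤+ = ℕ.≤-refl ∷ []

positives-sparse : ∀ {R} → Gapped R → ∃[ m ] Sparse m (positives R)
positives-sparse {[]}            _ = 0 , []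
positives-sparse {+ m ∷ _}       g = m , positives-sparse-from g
positives-sparse { -[1+ _ ] ∷ _} g rewrite positives-after-nonpositive g -≤+ = 0 , []

-- The negative exponents come with increasing absolute value, so they are collected in reverse.
reverse-negatives-sparse-from : ∀ {n R acc} → Gapped (-[1+ n ] ∷ R) → Sparse (n ℕ.∸ 1) acc →
                                ∃[ m ] Sparse m (reverseAcc (suc n ∷ acc) (negatives R))
reverse-negatives-sparse-from {n} (one _) s = suc n , ℕ.≤-refl ∷ s
reverse-negatives-sparse-from (cons {y = y} h g) s with gap-below-negative {y} h
... | _ , refl , n≤c = reverse-negatives-sparse-from g (s≤s n≤c ∷ s)

reverse-negatives-sparse : ∀ {R} → Gapped R → ∃[ m ] Sparse m (reverse (negatives R))
reverse-negatives-sparse {[]}            _ = 0 , []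
reverse-negatives-sparse {+ _ ∷ _}       g = reverse-negatives-sparse (Gapped-tail g)
reverse-negatives-sparse { -[1+ _ ] ∷ _} g = reverse-negatives-sparse-from g []

oddExps-split : ∀ {R} → Gapped R →
                oddExps R ≡ map +_ (odds (positives R)) ++ map (-_ ∘ +_) (odds (negatives R))
oddExps-split {[]}          _ = refl
oddExps-split {+ zero ∷ _}  g = oddExps-split (Gapped-tail g)
oddExps-split {+ suc n ∷ _} g with oddℕ (suc n)
... | true  = cong (+ suc n ∷_) (oddExps-split (Gapped-tail g))
... | false = oddExps-split (Gapped-tail g)
oddExps-split { -[1+ n ] ∷ _} g
  rewrite oddExps-split (Gapped-tail g) | positives-after-nonpositive g -≤+ with oddℕ (suc n)
... | true  = refl
... | false = refl

TwoOdds⇒exponents : ∀ {Q T T′ p q} → TwoOdds Q T → T ↭ T′ →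
                    map +_ Q ++ map (-_ ∘ +_) T′ ≡ p ∷ q ∷ [] →
                    ((p ≡ + 3) × (q ≡ + 1))
                    ⊎ (∃[ i ] ((+ 1 ≤ i) × (p ≡ + 2 * i + + 1) × (q ≡ + 1 - + 2 * i)))
TwoOdds⇒exponents three-one ρ eq with refl ← ↭-empty-inv (↭-sym ρ) | refl ← eq = inj₁ (refl , refl)
TwoOdds⇒exponents (adjacent {k} odd) ρ eq
  with refl ← ↭-singleton-inv (↭-sym ρ) | j , refl ← odd⇒suc-double {k} odd | refl ← eq =
  inj₂ (+ suc j , +≤+ (s≤s z≤n) , p-form (+ j) , q-form (+ j))
  where
  p-form : ∀ x → + 3 + (x + x) ≡ + 2 * (+ 1 + x) + + 1
  p-form = solve-∀
  q-form : ∀ x → - (+ 1 + (x + x)) ≡ + 1 - + 2 * (+ 1 + x)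
  q-form = solve-∀

two-odd-exponents : (n : ℕ) (R : List ℤ) (p q : ℤ) → IsPhiRep n R → oddExps R ≡ p ∷ q ∷ [] →
                    ((p ≡ + 3) × (q ≡ + 1))
                    ⊎ (∃[ i ] ((+ 1 ≤ i) × (p ≡ + 2 * i + + 1) × (q ≡ + 1 - + 2 * i)))
two-odd-exponents _ R p q rep@(gapped , _) oddExps≡pq =
  TwoOdds⇒exponents
    (twoOdds (proj₂ (positives-sparse gapped)) (proj₂ (reverse-negatives-sparse gapped)) balanced count)
    (odds-↭ (↭-reverse N)) split
  where
  open ≡-Reasoning
  P = positives R
  N = negatives R
  balanced : Balanced P (reverse N)
  balanced = Balanced-↭ {P = P} (↭-sym (↭-reverse N)) (IsPhiRep⇒Balanced rep)
  split : map +_ (odds P) ++ map (-_ ∘ +_) (odds N) ≡ p ∷ q ∷ []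
  split = trans (sym (oddExps-split gapped)) oddExps≡pq
  count : length (odds P) ℕ.+ length (odds (reverse N)) ≡ 2
  count = begin
    length (odds P) ℕ.+ length (odds (reverse N))
      ≡⟨ cong (length (odds P) ℕ.+_) (↭-length (odds-↭ (↭-reverse N))) ⟩
    length (odds P) ℕ.+ length (odds N)
      ≡⟨ cong₂ ℕ._+_ (length-map +_ (odds P)) (length-map (-_ ∘ +_) (odds N)) ⟨
    length (map +_ (odds P)) ℕ.+ length (map (-_ ∘ +_) (odds N))
      ≡⟨ length-++ (map +_ (odds P)) ⟨
    length (map +_ (odds P) ++ map (-_ ∘ +_) (odds N))
      ≡⟨ cong length split ⟩
    2 ∎

witness-3-1 : ∃[ n ] ∃[ R ] (IsPhiRep n R × oddExps R ≡ + 3 ∷ + 1 ∷ [])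
witness-3-1 = 6 , + 3 ∷ + 1 ∷ -[1+ 3 ] ∷ [] , (cons (+≤+ ℕ.≤-refl) (cons -≤+ (one _)) , refl) , refl

-- For u = 2i - 4 the exponents are 2i + 1, 2i - 2, 1 - 2i and -2i - 2.
adjacent-rep : ℕ → List ℤ
adjacent-rep u = + (5 ℕ.+ u) ∷ + (2 ℕ.+ u) ∷ -[1+ 2 ℕ.+ u ] ∷ -[1+ 5 ℕ.+ u ] ∷ []

adjacent-rep-gapped : ∀ u → Gapped (adjacent-rep u)
adjacent-rep-gapped u =
  cons (+≤+ (ℕ.≤-trans (ℕ.≤-reflexive (ℕ.+-comm (2 ℕ.+ u) 2)) (ℕ.n≤1+n _)))
       (cons -≤+ (cons (-≤- (ℕ.n≤1+n _)) (one _)))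

-- The φ-parts cancel because F_{6+u} = F_{5+u} + F_{3+u} + F_{2+u}.
adjacent-rep-value : ∀ u → oddℕ u ≡ false →
                     evalRep (adjacent-rep u) ≡ (+ (fib (1 ℕ.+ u) ℕ.+ fib (7 ℕ.+ u)) , + 0)
adjacent-rep-value u even =
  trans (cong₂ _⊕_ (φ^-pos (4 ℕ.+ u)) (cong₂ _⊕_ (φ^-pos (1 ℕ.+ u))
          (cong₂ _⊕_ (φ^-neg-even (2 ℕ.+ u) even)
            (cong (_⊕ (+ 0 , + 0)) (φ^-neg-odd (5 ℕ.+ u) (even⇒suc-odd u even))))))
        (cong₂ _,_ (a-part (+ fib (4 ℕ.+ u)) (+ fib (1 ℕ.+ u)) (+ fib (7 ℕ.+ u)))
                   (φ-part (+ fib (5 ℕ.+ u)) (+ fib (2 ℕ.+ u)) (+ fib (3 ℕ.+ u))))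
  where
  a-part : ∀ a b d → a + (b + (- a + (d + + 0))) ≡ b + d
  a-part = solve-∀
  φ-part : ∀ a b c → a + (b + (c + (- (a + (c + b)) + + 0))) ≡ + 0
  φ-part = solve-∀

adjacent-rep-odds : ∀ u → oddℕ u ≡ false →
                    oddExps (adjacent-rep u) ≡ + (5 ℕ.+ u) ∷ -[1+ 2 ℕ.+ u ] ∷ []
adjacent-rep-odds u even rewrite oddℕ-suc u | even = refl

witness-adjacent : (i : ℤ) → + 1 ≤ i →
                   ∃[ n ] ∃[ R ] (IsPhiRep n R × oddExps R ≡ (+ 2 * i + + 1) ∷ (+ 1 - + 2 * i) ∷ [])
witness-adjacent (+ 1) _ =
  5 , + 3 ∷ -[1+ 0 ] ∷ -[1+ 3 ] ∷ [] , (cons (+≤+ (s≤s z≤n)) (cons (-≤- z≤n) (one _)) , refl) , refl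
witness-adjacent (+ suc (suc t)) _ =
  _ , adjacent-rep (t ℕ.+ t) ,
  (adjacent-rep-gapped (t ℕ.+ t) , adjacent-rep-value (t ℕ.+ t) (oddℕ-double t)) ,
  trans (adjacent-rep-odds (t ℕ.+ t) (oddℕ-double t))
        (cong₂ (λ p q → p ∷ q ∷ []) (p-form (+ t)) (q-form (+ t)))
  where
  p-form : ∀ x → + 5 + (x + x) ≡ + 2 * (+ 2 + x) + + 1
  p-form = solve-∀
  q-form : ∀ x → - (+ 3 + (x + x)) ≡ + 1 - + 2 * (+ 2 + x)
  q-form = solve-∀
witness-adjacent (+ 0)    (+≤+ ())
witness-adjacent -[1+ _ ] ()

theorem9 :
    ((n : ℕ) (R : List ℤ) (p q : ℤ) → IsPhiRep n R → oddExps R ≡ p ∷ q ∷ [] →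
      ((p ≡ + 3) × (q ≡ + 1))
      ⊎ (∃[ i ] ((+ 1 ≤ i) × (p ≡ + 2 * i + + 1) × (q ≡ + 1 - + 2 * i))))
    ×
    ((∃[ n ] ∃[ R ] (IsPhiRep n R × oddExps R ≡ + 3 ∷ + 1 ∷ []))
     × ((i : ℤ) → + 1 ≤ i →
          ∃[ n ] ∃[ R ] (IsPhiRep n R × oddExps R ≡ (+ 2 * i + + 1) ∷ (+ 1 - + 2 * i) ∷ [])))
theorem9 = two-odd-exponents , witness-3-1 , witness-adjacent
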